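{- Let $A_0,\dots,A_m$ be transition systems with pairwise disjoint state sets, let $U=U(A_0,\dots,A_m)$ be their union, and let $A(U)$ be a joining of $U$ (for an arbitrary choice of the discretionary states $t^0\in S_0,\dots,t^{m-1}\in S_{m-1}$). Then $U$ has the SSP if and only if $A(U)$ has the SSP, and $U$ is feasible if and only if $A(U)$ is feasible.
   Context: A transition system (TS) is $A=(S,E,\delta,s_0)$ with finite disjoint sets $S$ (states), $E$ (events), a partial function $\delta:S\times E\to S$ (edges $s\xrightarrow{e}s'$ when $\delta(s,e)=s'$) and initial state $s_0$; TSs are simple (no two distinct events label edges between the same ordered pair of states), loop-free, reachable from $s_0$, and reduced (every event labels an edge). For a TS, a region is a set $R$ of states with a signature $sig_R:E\to\{ -1,0,1\}$ such that $R(s')=R(s)+sig_R(e)$ for every edge $s\xrightarrow{e}s'$ ($R(s)\in\{0,1\}$ is the indicator of $s\in R$); separability, inhibitability ($R(s)=0, sig_R(e)=-1$ or $R(s)=1, sig_R(e)=1$), SSP (all distinct states separable), ESSP (every event inhibitable at every state where it does not occur) and feasibility (SSP and ESSP) are defined as usual. Union: for TSs $A_i=(S_i,E_i,\delta_i,s^i_0)$, $i=0,\dots,m$, with pairwise disjoint state sets (event sets may overlap), $U=U(A_0,\dots,A_m)$ has state set $S(U)=\bigcup S_i$ and event set $E(U)=\bigcup E_i$. A region of $U$ is a set $R\subseteq S(U)$ with a signature $sig_R:E(U)\to\{ -1,0,1\}$ such that for every $i$, $R\cap S_i$ is a region of $A_i$ whose signature agrees with $sig_R$ on $E_i$. $U$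 has the SSP if any two distinct states of the same $A_i$ are separated by $R\cap S_i$ for some region $R$ of $U$ (states in different components need no separation). $U$ has the ESSP if for every $e\in E(U)$ and every state $s\in S_i$ such that $e$ does not occur at $s$ in $A_i$, there is a region $R$ of $U$ with ($R(s)=0$ and $sig_R(e)=-1$) or ($R(s)=1$ and $sig_R(e)=1$). $U$ is feasible if it has SSP and ESSP. Joining: choose states $t^i\in S_i$ for $i\in\{0,\dots,m-1\}$; $A(U)$ is the TS with states $S(U)\cup\{z^1,\dots,z^m\}$, events $E(U)\cup\{y^i_1,y^i_2: 1\le i\le m\}$ (all new and distinct), initial state $s^0_0$, whose edges are all edges of all $A_i$ together with $t^{i-1}\xrightarrow{y^i_1}z^i$ and $z^i\xrightarrow{y^i_2}s^i_0$ for $i\in\{1,\dots,m\}$. -}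

module Defs where

open import Data.Nat using (ℕ; suc)
open import Data.Fin using (Fin; zero; suc; inject₁; _≟_)
open import Data.Bool using (Bool; true; false)
open import Data.Maybe using (Maybe; just; nothing)
import Data.Maybe as Maybe
open import Data.Product using (Σ; ∃; ∃-syntax; _×_; _,_)
open import Data.Sum using (_⊎_; inj₁; inj₂)
open import Relation.Nullary using (¬_; yes; no)
open import Relation.Binary.PropositionalEquality using (_≡_; _≢_; refl)

-- Transition systems (states S, events E, partial transition function δ,
-- initial state s₀).  Finiteness is imposed where the TSs are used
-- (components have Fin-typed state and event sets).

record TS (S E : Set) : Set where
  field
    δ  : S → E → Maybe S
    s₀ : S
open TS public

module _ {S E : Set} (A : TS S E) where

  Edge : S → E → S → Set
  Edge s e s' = δ A s e ≡ just s'

  Occurs : E → S → Set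
  Occurs e s = ∃[ s' ] Edge s e s'

  Simple : Set
  Simple = ∀ s s' e e' → Edge s e s' → Edge s e' s' → e ≡ e'

  LoopFree : Set
  LoopFree = ∀ s e → ¬ Edge s e s

  data Reach : S → Set where
    here : Reach (s₀ A)
    step : ∀ {s e s'} → Reach s → Edge s e s' → Reach s'

  Reachable : Set
  Reachable = ∀ s → Reach s

  Reduced : Set
  Reduced = ∀ e → ∃[ s ] ∃[ s' ] Edge s e s'

data Sig : Set where
  minus zer plus : Sig

-- R(s') = R(s) + sig(e), with R(s), R(s') ∈ {0,1}
data Step : Bool → Sig → Bool → Set where
  keep0 : Step false zer false
  keep1 : Step true zer true
  enter : Step false plus true
  exit  : Step true minus false

module _ {S E : Set} (A : TS S E) where

  IsRegion : (S → Bool) → (E → Sig) → Set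
  IsRegion R sig = ∀ s e s' → Edge A s e s' → Step (R s) (sig e) (R s')

  SSP : Set
  SSP = ∀ (s s' : S) → s ≢ s' →
        ∃[ R ] ∃[ sig ] (IsRegion R sig × R s ≢ R s')

  ESSP : Set
  ESSP = ∀ (e : E) (s : S) → ¬ Occurs A e s →
         ∃[ R ] ∃[ sig ] (IsRegion R sig × Inhibits R sig s e)
    where
    Inhibits : (S → Bool) → (E → Sig) → S → E → Set
    Inhibits R sig s e = (R s ≡ false × sig e ≡ minus) ⊎ (R s ≡ true × sig e ≡ plus)

  Feasible : Set
  Feasible = SSP × ESSP

IsTS : {S E : Set} → TS S E → Set
IsTS A = Simple A × LoopFree A × Reachable A

-- Components are indexed by i : Fin (suc m); component
-- i has states Fin (n i) (the state sets are made pairwise disjoint by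
-- tagging them with i) and its events are those events of the common
-- universe Fin k that label an edge of it.  E(U) = Fin k.

module Union {m : ℕ} {n : Fin (suc m) → ℕ} {k : ℕ}
             (A : (i : Fin (suc m)) → TS (Fin (n i)) (Fin k)) where

  -- E(U) is exactly the union of the component event sets
  UReduced : Set
  UReduced = ∀ e → ∃[ i ] ∃[ s ] ∃[ s' ] Edge (A i) s e s'

  IsURegion : ((i : Fin (suc m)) → Fin (n i) → Bool) → (Fin k → Sig) → Set
  IsURegion R sig = ∀ i → IsRegion (A i) (R i) sig

  USSP : Set
  USSP = ∀ i (s s' : Fin (n i)) → s ≢ s' →
         ∃[ R ] ∃[ sig ] (IsURegion R sig × R i s ≢ R i s')

  UESSP : Set
  UESSP = ∀ (e : Fin k) i (s : Fin (n i)) → ¬ Occurs (A i) e s →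
          ∃[ R ] ∃[ sig ] (IsURegion R sig ×
            ((R i s ≡ false × sig e ≡ minus) ⊎ (R i s ≡ true × sig e ≡ plus)))

  UFeasible : Set
  UFeasible = USSP × UESSP

  -- Joining A(U).  t j = t^j ∈ S_j for j = 0..m-1 (j : Fin m, component
  -- inject₁ j).  New state z^{j+1} is  inj₂ j ; new events y^{j+1}_1 and
  -- y^{j+1}_2 are  inj₂ (inj₁ j)  and  inj₂ (inj₂ j).

  JState : Set
  JState = Σ (Fin (suc m)) (λ i → Fin (n i)) ⊎ Fin m

  JEvent : Set
  JEvent = Fin k ⊎ (Fin m ⊎ Fin m)

  module _ (t : (j : Fin m) → Fin (n (inject₁ j))) where

    jδ : JState → JEvent → Maybe JState
    jδ (inj₁ (i , s)) (inj₁ e) = Maybe.map (λ s' → inj₁ (i , s')) (δ (A i) s e)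
    jδ (inj₁ (i , s)) (inj₂ (inj₁ j)) with i ≟ inject₁ j
    ... | no _ = nothing
    ... | yes refl with s ≟ t j
    ...   | yes _ = just (inj₂ j)
    ...   | no _ = nothing
    jδ (inj₁ _) (inj₂ (inj₂ _)) = nothing
    jδ (inj₂ _) (inj₁ _) = nothing
    jδ (inj₂ _) (inj₂ (inj₁ _)) = nothing
    jδ (inj₂ j) (inj₂ (inj₂ j')) with j ≟ j'
    ... | yes _ = just (inj₁ (suc j , s₀ (A (suc j))))
    ... | no _ = nothing

    Join : TS JState JEvent
    Join = record { δ = jδ ; s₀ = inj₁ (zero , s₀ (A zero)) }

module Submission where

-- Every edge of the joining A(U) is either an edge of a component A_i, or
-- one of the two connector edges  t^j --y¹_j--> z^j --y²_j--> s₀^{j+1}.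
-- Hence
--  * a region of A(U) restricts to a region of U (forget the states z^j and
--    the events y), which gives the directions  A(U) ⇒ U;
--  * a region of U together with ANY choice of values on the z^j extends to
--    a region of A(U): the signatures of y¹_j, y²_j are forced to be the
--    difference of the values at their endpoints.
-- For the directions  U ⇒ A(U)  we therefore only have to choose suitable
-- regions of U and values on the z^j.  Separation across components uses
-- the indicator region of a component; a z^j is separated by the region
-- {z^j}.  For inhibition we use one general fact about any TS: if a region
-- separates the endpoints of some e-edge, then e is inhibited at every
-- state whose value equals that at the target of the edge.

open import Defs
open import Data.Nat using (ℕ; suc)
open import Data.Fin using (Fin; inject₁; zero; suc; _≟_)
open import Data.Bool using (Bool; true; false)
open import Data.Maybe using (Maybe; just)
import Data.Maybe as Maybe
open import Data.Product using (_×_; _,_; Σ; ∃-syntax; proj₁; proj₂)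
open import Data.Sum using (_⊎_; inj₁; inj₂)
open import Data.Empty using (⊥-elim)
open import Function.Bundles using (_⇔_; mk⇔)
open import Relation.Nullary using (¬_; yes; no; does)
open import Relation.Nullary.Decidable using (dec-true; dec-false)
open import Relation.Binary.PropositionalEquality
  using (_≡_; _≢_; refl; sym; cong; subst)

Inhibits : Bool → Sig → Set
Inhibits b g = (b ≡ false × g ≡ minus) ⊎ (b ≡ true × g ≡ plus)

diff : Bool → Bool → Sig
diff false false = zer
diff false true  = plus
diff true  false = minus
diff true  true  = zer

step-diff : ∀ a b → Step a (diff a b) b
step-diff false false = keep0
step-diff false true  = enter
step-diff true  false = exit
step-diff true  true  = keep1

true-false-distinct : ∀ {a b} → a ≡ true → b ≡ false → a ≢ b
true-false-distinct refl refl ()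

target-inhibits : ∀ {a g b} → Step a g b → a ≢ b → Inhibits b g
target-inhibits keep0 a≢b = ⊥-elim (a≢b refl)
target-inhibits keep1 a≢b = ⊥-elim (a≢b refl)
target-inhibits enter _   = inj₂ (refl , refl)
target-inhibits exit  _   = inj₁ (refl , refl)

edge-inhibits : ∀ {S E} (T : TS S E) {R sig x} → IsRegion T R sig →
                ∀ u e v → Edge T u e v → R u ≢ R v → R x ≡ R v →
                ∃[ R′ ] ∃[ sig′ ] (IsRegion T R′ sig′ × Inhibits (R′ x) (sig′ e))
edge-inhibits T {R} {sig} reg u e v edge sep same =
  R , sig , reg ,
  subst (λ b → Inhibits b (sig e)) (sym same) (target-inhibits (reg u e v edge) sep)

module Joining {m : ℕ} {n : Fin (suc m) → ℕ} {k : ℕ}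
               (A : (i : Fin (suc m)) → TS (Fin (n i)) (Fin k))
               (t : (j : Fin m) → Fin (n (inject₁ j))) where
  open Union A

  J : TS JState JEvent
  J = Join t

  UState : Set
  UState = Σ (Fin (suc m)) (λ i → Fin (n i))

  UValue : ((i : Fin (suc m)) → Fin (n i) → Bool) → UState → Bool
  UValue R (i , s) = R i s

  y¹ y² : Fin m → JEvent
  y¹ j = inj₂ (inj₁ j)
  y² j = inj₂ (inj₂ j)

  after-z : Fin m → JState
  after-z j = inj₁ (suc j , s₀ (A (suc j)))

  data JEdge : JState → JEvent → JState → Set where
    component : ∀ {i s e s'} → Edge (A i) s e s' →
                JEdge (inj₁ (i , s)) (inj₁ e) (inj₁ (i , s'))
    enter-z   : ∀ j → JEdge (inj₁ (inject₁ j , t j)) (y¹ j) (inj₂ j)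
    leave-z   : ∀ j → JEdge (inj₂ j) (y² j) (after-z j)

  lift-edge : ∀ {i s e s'} → Edge (A i) s e s' →
              Edge J (inj₁ (i , s)) (inj₁ e) (inj₁ (i , s'))
  lift-edge d = cong (Maybe.map _) d

  y¹-edge : ∀ j → Edge J (inj₁ (inject₁ j , t j)) (y¹ j) (inj₂ j)
  y¹-edge j with inject₁ j ≟ inject₁ j
  ... | no ne = ⊥-elim (ne refl)
  ... | yes refl with t j ≟ t j
  ...   | yes _ = refl
  ...   | no ne = ⊥-elim (ne refl)

  y²-edge : ∀ j → Edge J (inj₂ j) (y² j) (after-z j)
  y²-edge j with j ≟ j
  ... | yes _ = refl
  ... | no ne = ⊥-elim (ne refl)

  classify : ∀ x ev y → Edge J x ev y → JEdge x ev y
  classify (inj₁ (i , s)) (inj₁ e) y eq = component-edge (δ (A i) s e) refl eq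
    where
    component-edge : (r : Maybe (Fin (n i))) → δ (A i) s e ≡ r →
                     Maybe.map (λ s' → inj₁ (i , s')) r ≡ just y →
                     JEdge (inj₁ (i , s)) (inj₁ e) y
    component-edge (just s') d refl = component d
  classify (inj₁ (i , s)) (inj₂ (inj₁ j)) y eq with i ≟ inject₁ j
  classify (inj₁ (i , s)) (inj₂ (inj₁ j)) y () | no _
  ... | yes refl with s ≟ t j
  classify (inj₁ (i , s)) (inj₂ (inj₁ j)) y () | yes refl | no _
  classify (inj₁ (i , s)) (inj₂ (inj₁ j)) .(inj₂ j) refl | yes refl | yes refl = enter-z j
  classify (inj₁ _) (inj₂ (inj₂ _)) y ()
  classify (inj₂ _) (inj₁ _) y ()
  classify (inj₂ _) (inj₂ (inj₁ _)) y ()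
  classify (inj₂ j) (inj₂ (inj₂ j')) y eq with j ≟ j'
  classify (inj₂ j) (inj₂ (inj₂ j')) y () | no _
  classify (inj₂ j) (inj₂ (inj₂ .j)) ._ refl | yes refl = leave-z j

  extend : ((i : Fin (suc m)) → Fin (n i) → Bool) → (Fin m → Bool) → JState → Bool
  extend R Z (inj₁ p) = UValue R p
  extend R Z (inj₂ j) = Z j

  extend-sig : ((i : Fin (suc m)) → Fin (n i) → Bool) → (Fin k → Sig) → (Fin m → Bool) →
               JEvent → Sig
  extend-sig R sig Z (inj₁ e)        = sig e
  extend-sig R sig Z (inj₂ (inj₁ j)) = diff (R (inject₁ j) (t j)) (Z j)
  extend-sig R sig Z (inj₂ (inj₂ j)) = diff (Z j) (R (suc j) (s₀ (A (suc j))))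

  -- Any choice of Z extends a region of U: connector signatures are forced differences.
  extend-region : ∀ {R sig} Z → IsURegion R sig →
                  IsRegion J (extend R Z) (extend-sig R sig Z)
  extend-region Z reg x ev y edge with classify x ev y edge
  ... | component {i} {s} {e} {s'} d = reg i s e s' d
  ... | enter-z j = step-diff _ _
  ... | leave-z j = step-diff _ _

  restrict-region : ∀ {R sig} → IsRegion J R sig →
                    IsURegion (λ i s → R (inj₁ (i , s))) (λ e → sig (inj₁ e))
  restrict-region reg i s e s' d = reg (inj₁ (i , s)) (inj₁ e) (inj₁ (i , s')) (lift-edge d)

  whole : Fin (suc m) → (i : Fin (suc m)) → Fin (n i) → Bool
  whole c i _ = does (i ≟ c)

  whole-region : ∀ c → IsURegion (whole c) (λ _ → zer)
  whole-region c i _ _ _ _ with does (i ≟ c)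
  ... | false = keep0
  ... | true  = keep1

  empty-region : IsURegion (λ _ _ → false) (λ _ → zer)
  empty-region _ _ _ _ _ = keep0

  -- Values for the z states describing {z^j}; extended by the empty region of U
  -- it is the region {z^j} of the joining.  (The region of all z's is the
  -- extension of the empty region by the constant value true.)
  only-z : Fin m → Fin m → Bool
  only-z j j' = does (j' ≟ j)

  only-z-value : ∀ j x → x ≢ inj₂ j → extend (λ _ _ → false) (only-z j) x ≡ false
  only-z-value j (inj₁ _)  _  = refl
  only-z-value j (inj₂ j') ne = dec-false (j' ≟ j) (λ j'≡j → ne (cong inj₂ j'≡j))

  only-z-at-z : ∀ j → only-z j j ≡ true
  only-z-at-z j = dec-true (j ≟ j) refl

  separate-U : USSP → (p q : UState) → p ≢ q →
               ∃[ R ] ∃[ sig ] (IsURegion R sig × UValue R p ≢ UValue R q)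
  separate-U ussp (i , s) (i' , s') ne with i ≟ i'
  ... | yes refl = ussp i s s' (λ s≡s' → ne (cong (i ,_) s≡s'))
  ... | no i≢i' = whole i , _ , whole-region i ,
    true-false-distinct (dec-true (i ≟ i) refl) (dec-false (i' ≟ i) (λ eq → i≢i' (sym eq)))

  ssp-reflect : SSP J → USSP
  ssp-reflect ssp i s s' ne with ssp (inj₁ (i , s)) (inj₁ (i , s')) (λ { refl → ne refl })
  ... | R , sig , reg , sep = _ , _ , restrict-region reg , sep

  separate-z : ∀ j x → x ≢ inj₂ j →
               ∃[ R ] ∃[ sig ] (IsRegion J R sig × R (inj₂ j) ≢ R x)
  separate-z j x ne = _ , _ , extend-region (only-z j) empty-region ,
    true-false-distinct (only-z-at-z j) (only-z-value j x ne)

  ssp-preserve : USSP → SSP J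
  ssp-preserve ussp (inj₁ p) (inj₁ q) ne with separate-U ussp p q (λ { refl → ne refl })
  ... | R , sig , reg , sep = _ , _ , extend-region (λ _ → false) reg , sep
  ssp-preserve ussp (inj₂ j) x ne = separate-z j x (λ eq → ne (sym eq))
  ssp-preserve ussp (inj₁ p) (inj₂ j) ne with separate-z j (inj₁ p) (λ ())
  ... | R , sig , reg , sep = R , sig , reg , λ eq → sep (sym eq)

  -- An event of U not occurring at s in A_i does not occur at s in the joining
  -- either; restricting the inhibiting region gives one of U.
  essp-reflect : ESSP J → UESSP
  essp-reflect essp e i s nocc with essp (inj₁ e) (inj₁ (i , s)) nocc-J
    where
    nocc-J : ¬ Occurs J (inj₁ e) (inj₁ (i , s))
    nocc-J (y , d) with classify (inj₁ (i , s)) (inj₁ e) y d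
    ... | component {s' = s'} d' = nocc (s' , d')
  ... | R , sig , reg , inh = _ , _ , restrict-region reg , inh

  InhibitedAt : JState → JEvent → Set
  InhibitedAt x ev = ∃[ R ] ∃[ sig ] (IsRegion J R sig × Inhibits (R x) (sig ev))

  -- At z^j we use
  -- some edge s --e--> s' of U (reducedness); it is a proper step (loop-freeness),
  -- so a region separating s and s' inhibits e at z^j once z^j gets R(s').
  inhibit-original : (∀ i → LoopFree (A i)) → UReduced → USSP → UESSP →
                     ∀ e x → ¬ Occurs J (inj₁ e) x → InhibitedAt x (inj₁ e)
  inhibit-original _ _ _ uessp e (inj₁ (i , s)) nocc
    with uessp e i s (λ (s' , d) → nocc (inj₁ (i , s') , lift-edge d))
  ... | R , sig , reg , inh = _ , _ , extend-region (λ _ → false) reg , inh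
  inhibit-original loop-free ured ussp _ e (inj₂ j) _ with ured e
  ... | i , s , s' , d with ussp i s s' (λ { refl → loop-free i s e d })
  ...   | R , sig , reg , sep =
    edge-inhibits J (extend-region (λ _ → R i s') reg)
      (inj₁ (i , s)) (inj₁ e) (inj₁ (i , s')) (lift-edge d) sep refl

  -- y¹_j is inhibited at a component state p ≠ t^j by a region of U separating
  -- t^j from p, with z^j valued like p; at any z state by the region of all z's.
  inhibit-y¹ : USSP → ∀ j x → ¬ Occurs J (y¹ j) x → InhibitedAt x (y¹ j)
  inhibit-y¹ ussp j (inj₁ p) nocc
    with separate-U ussp (inject₁ j , t j) p (λ { refl → nocc (_ , y¹-edge j) })
  ... | R , sig , reg , sep =
    edge-inhibits J (extend-region (λ _ → UValue R p) reg)
      (inj₁ (inject₁ j , t j)) (y¹ j) (inj₂ j) (y¹-edge j) sep refl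
  inhibit-y¹ _ j (inj₂ j') _ =
    edge-inhibits J (extend-region (λ _ → true) empty-region)
      (inj₁ (inject₁ j , t j)) (y¹ j) (inj₂ j) (y¹-edge j) (λ ()) refl

  -- y²_j is inhibited at component states by the region of all z's, and at
  -- z^{j'} ≠ z^j by the region {z^j}.
  inhibit-y² : ∀ j x → ¬ Occurs J (y² j) x → InhibitedAt x (y² j)
  inhibit-y² j (inj₁ p) _ =
    edge-inhibits J (extend-region (λ _ → true) empty-region)
      (inj₂ j) (y² j) (after-z j) (y²-edge j) (λ ()) refl
  inhibit-y² j (inj₂ j') nocc =
    edge-inhibits J (extend-region (only-z j) empty-region)
      (inj₂ j) (y² j) (after-z j) (y²-edge j)
      (true-false-distinct (only-z-at-z j) refl)
      (only-z-value j (inj₂ j') (λ { refl → nocc (_ , y²-edge j) }))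

  essp-preserve : (∀ i → LoopFree (A i)) → UReduced → USSP → UESSP → ESSP J
  essp-preserve loop-free ured ussp uessp (inj₁ e) =
    inhibit-original loop-free ured ussp uessp e
  essp-preserve _ _ ussp _ (inj₂ (inj₁ j)) = inhibit-y¹ ussp j
  essp-preserve _ _ _ _    (inj₂ (inj₂ j)) = inhibit-y² j

lemma1 : (m : ℕ) (n : Fin (suc m) → ℕ) (k : ℕ)
         (A : (i : Fin (suc m)) → TS (Fin (n i)) (Fin k))
         (t : (j : Fin m) → Fin (n (inject₁ j))) →
         (∀ i → IsTS (A i)) → Union.UReduced A →
         (Union.USSP A ⇔ SSP (Union.Join A t))
         × (Union.UFeasible A ⇔ Feasible (Union.Join A t))
lemma1 m n k A t ts ured =
  mk⇔ ssp-preserve ssp-reflect ,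
  mk⇔ (λ (ussp , uessp) → ssp-preserve ussp , essp-preserve loop-free ured ussp uessp)
      (λ (ssp , essp) → ssp-reflect ssp , essp-reflect essp)
  where
  open Joining A t
  loop-free : ∀ i → LoopFree (A i)
  loop-free i = proj₁ (proj₂ (ts i))
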